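{- Let $n\ge 5$ and let $\sigma$ be a maximal simplex of $\Delta_n=\mathcal{VR}(\mathbb{I}_n;3)$ that covers all places, and suppose $|N(w)\cap\sigma|\ge 2$ for all $w\in\sigma$. If there exists $v\in\sigma$ with $|N(v)\cap\sigma|\ge 3$, then $N(v)\subseteq\sigma$.
   Context: $\mathbb{I}_n$ is the graph on $\{0,1\}^n$, two strings adjacent iff they differ in exactly one coordinate; distance is the number of differing coordinates. $\Delta_n=\mathcal{VR}(\mathbb{I}_n;3)$ is the simplicial complex whose simplices are the sets of vertices with pairwise distance at most $3$. For a vertex $v$, $v(i)$ is its $i$-th coordinate and $N(v)$ is its set of neighbours in $\mathbb{I}_n$. A simplex $\sigma$ covers all places if for each $i\in[n]$ there are $v,w\in\sigma$ with $v(i)=1$ and $w(i)=0$. -}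

module Defs where

open import Data.Nat using (ℕ; zero; suc; _+_; _≤_)
open import Data.Bool using (Bool; true; false; _≟_; not; T)
open import Data.Fin using (Fin)
open import Data.Vec using (Vec; lookup; updateAt; allFin)
open import Data.Vec.Functional using () renaming (Vector to FVec)
open import Data.List using (List; length; filter; tabulate)
open import Data.Product using (Σ; _×_; ∃; ∃-syntax; _,_)
open import Relation.Nullary using (¬_)
open import Relation.Nullary.Decidable using (does)
open import Relation.Binary.PropositionalEquality using (_≡_)

Vertex : ℕ → Set
Vertex n = Vec Bool n

-- Hamming distance (= graph distance in 𝕀ₙ), by recursion on the vectors.
dist : ∀ {n} → Vertex n → Vertex n → ℕ
dist Vec.[] Vec.[] = 0
dist (x Vec.∷ xs) (y Vec.∷ ys) = (if does (x ≟ y) then 0 else 1) + dist xs ys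
  where open import Data.Bool using (if_then_else_)

-- A set of vertices of 𝕀ₙ (the vertex set is finite, so subsets are Bool-valued).
VSet : ℕ → Set
VSet n = Vertex n → Bool

_∈ₛ_ : ∀ {n} → Vertex n → VSet n → Set
v ∈ₛ σ = σ v ≡ true

IsSimplex : ∀ {n} → VSet n → Set
IsSimplex {n} σ = (∃[ v ] v ∈ₛ σ) × (∀ v w → v ∈ₛ σ → w ∈ₛ σ → dist v w ≤ 3)

IsMaximalSimplex : ∀ {n} → VSet n → Set
IsMaximalSimplex {n} σ =
  IsSimplex σ × (∀ (τ : VSet n) → IsSimplex τ → (∀ v → v ∈ₛ σ → v ∈ₛ τ) → ∀ v → v ∈ₛ τ → v ∈ₛ σ)

CoversAllPlaces : ∀ {n} → VSet n → Set
CoversAllPlaces {n} σ = ∀ (i : Fin n) →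
  ∃[ v ] ∃[ w ] (v ∈ₛ σ × w ∈ₛ σ × lookup v i ≡ true × lookup w i ≡ false)

neighbours : ∀ {n} → Vertex n → List (Vertex n)
neighbours {n} v = tabulate (λ i → updateAt v i not)

_∈N_ : ∀ {n} → Vertex n → Vertex n → Set
w ∈N v = dist v w ≡ 1

degIn : ∀ {n} → VSet n → Vertex n → ℕ
degIn σ v = length (filter (λ w → T? (σ w)) (neighbours v))
  where open import Data.Bool.Properties using () renaming (T? to T?)

-- Suppose some y ∈ σ is at distance ≥ 4 from the neighbour v + eᵢ. Then y agrees with v at i and
-- d(y,v) = 3, so y differs from v in every direction j with v + eⱼ ∈ σ; there are at least three
-- such directions, none equal to i. Take x ∈ σ differing from v at i (σ covers place i). Then
-- d(x,v) = 2: it is ≥ 2 because d(x,v) + d(x,y) ≥ d(v,y) + 2 = 5, as x differs from both at i where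
-- they agree; and it is not 3, for then x would also differ from v in all those directions j,
-- giving d(x,v) ≥ 4. Now x has two neighbours in σ, so one of them is x + eⱼ with j ≠ i; it still
-- differs from v at i, hence d(x + eⱼ, v) = 2 = d(x,v), which contradicts parity. So v + eᵢ is
-- within distance 3 of all of σ and maximality puts it in σ.

module Submission where

open import Defs
open import Data.Nat using (ℕ; suc; _+_; _≤_; _<_; z≤n; s≤s; _≤?_)
open import Data.Nat.Properties
  using (≤-refl; ≤-trans; ≤-reflexive; ≤-antisym; ≤-pred; n≤1+n; <-irrefl; <⇒≱; ≤∧≢⇒<; ≰⇒>;
         1+n≢n; suc-injective; +-suc; +-mono-≤; +-monoʳ-≤; +-cancelʳ-≤; +-commutativeSemigroup)
open import Algebra.Properties.CommutativeSemigroup +-commutativeSemigroup using (interchange; x∙yz≈y∙xz)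
open import Data.Bool using (Bool; true; false; not; _∨_; if_then_else_) renaming (_≟_ to _≟ᵇ_)
open import Data.Bool.Properties using (T?; T-≡; ∨-zeroʳ)
open import Data.Fin using (Fin) renaming (_≟_ to _≟ᶠ_; zero to fzero; suc to fsuc)
open import Data.Vec using ([]; _∷_; lookup; updateAt)
open import Data.Vec.Properties using (lookup∘updateAt′; ≡-dec)
open import Data.List using (List; []; _∷_; length; filter; map; allFin)
open import Data.List.Properties using (map-tabulate)
open import Data.List.Relation.Unary.All as All using (All; []; _∷_)
open import Data.List.Relation.Unary.All.Properties using (all-filter)
open import Data.List.Relation.Unary.AllPairs using ([]; _∷_)
open import Data.List.Relation.Unary.Unique.Propositional using (Unique)
open import Data.List.Relation.Unary.Unique.Propositional.Properties using (filter⁺; allFin⁺)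
open import Data.Product using (_×_; _,_; ∃-syntax; proj₁; proj₂)
open import Data.Sum using (_⊎_; inj₁; inj₂)
open import Data.Empty using (⊥; ⊥-elim)
open import Function using (_∘_)
open import Function.Bundles using (Equivalence)
open import Level using (0ℓ)
open import Relation.Nullary using (yes; no; does; contradiction)
open import Relation.Nullary.Decidable using (dec-true)
open import Relation.Unary using (Pred; Decidable)
open import Relation.Binary.PropositionalEquality
  using (_≡_; _≢_; refl; sym; trans; cong; subst; module ≡-Reasoning)

flipAt : ∀ {n} → Vertex n → Fin n → Vertex n
flipAt v i = updateAt v i not

lookup-flipAt-≢ : ∀ {n} (q : Vertex n) {j k : Fin n} → j ≢ k → lookup (flipAt q j) k ≡ lookup q k
lookup-flipAt-≢ q {j} {k} j≢k = lookup∘updateAt′ k j (j≢k ∘ sym) q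

-- The summand of dist, so that dist (x ∷ xs) (y ∷ ys) reduces to bitDist x y + dist xs ys.
bitDist : Bool → Bool → ℕ
bitDist b c = if does (b ≟ᵇ c) then 0 else 1

dist-refl : ∀ {n} (x : Vertex n) → dist x x ≡ 0
dist-refl [] = refl
dist-refl (false ∷ xs) = dist-refl xs
dist-refl (true ∷ xs) = dist-refl xs

dist-sym : ∀ {n} (x y : Vertex n) → dist x y ≡ dist y x
dist-sym [] [] = refl
dist-sym (false ∷ xs) (false ∷ ys) = dist-sym xs ys
dist-sym (true ∷ xs) (true ∷ ys) = dist-sym xs ys
dist-sym (false ∷ xs) (true ∷ ys) = cong suc (dist-sym xs ys)
dist-sym (true ∷ xs) (false ∷ ys) = cong suc (dist-sym xs ys)

+-mono-≤-interchange : ∀ {a b} c d e f → a ≤ c + e → b ≤ d + f → a + b ≤ (c + d) + (e + f)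
+-mono-≤-interchange c d e f a≤ b≤ = ≤-trans (+-mono-≤ a≤ b≤) (≤-reflexive (interchange c e d f))

bitDist-triangle : ∀ x p q → bitDist p q ≤ bitDist x p + bitDist x q
bitDist-triangle false false false = z≤n
bitDist-triangle false false true = s≤s z≤n
bitDist-triangle false true false = s≤s z≤n
bitDist-triangle false true true = z≤n
bitDist-triangle true false false = z≤n
bitDist-triangle true false true = s≤s z≤n
bitDist-triangle true true false = s≤s z≤n
bitDist-triangle true true true = z≤n

dist-triangle : ∀ {n} (x p q : Vertex n) → dist p q ≤ dist x p + dist x q
dist-triangle [] [] [] = z≤n
dist-triangle (x ∷ xs) (p ∷ ps) (q ∷ qs) =
  +-mono-≤-interchange (bitDist x p) (dist xs ps) (bitDist x q) (dist xs qs)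
    (bitDist-triangle x p q) (dist-triangle xs ps qs)

dist-detour : ∀ {n} (x p q : Vertex n) (i : Fin n) →
  lookup p i ≡ lookup q i → lookup x i ≢ lookup p i → 2 + dist p q ≤ dist x p + dist x q
dist-detour (true ∷ xs) (true ∷ ps) (_ ∷ qs) fzero refl x≢p = ⊥-elim (x≢p refl)
dist-detour (false ∷ xs) (false ∷ ps) (_ ∷ qs) fzero refl x≢p = ⊥-elim (x≢p refl)
dist-detour (true ∷ xs) (false ∷ ps) (_ ∷ qs) fzero refl _ =
  +-mono-≤-interchange 1 (dist xs ps) 1 (dist xs qs) ≤-refl (dist-triangle xs ps qs)
dist-detour (false ∷ xs) (true ∷ ps) (_ ∷ qs) fzero refl _ =
  +-mono-≤-interchange 1 (dist xs ps) 1 (dist xs qs) ≤-refl (dist-triangle xs ps qs)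
dist-detour (x ∷ xs) (p ∷ ps) (q ∷ qs) (fsuc i) p≡q x≢p =
  ≤-trans (≤-reflexive (x∙yz≈y∙xz 2 (bitDist p q) (dist ps qs)))
    (+-mono-≤-interchange (bitDist x p) (dist xs ps) (bitDist x q) (dist xs qs)
      (bitDist-triangle x p q) (dist-detour xs ps qs i p≡q x≢p))

dist-flipAt-agree : ∀ {n} (x q : Vertex n) (j : Fin n) →
  lookup x j ≡ lookup q j → dist x (flipAt q j) ≡ suc (dist x q)
dist-flipAt-agree (false ∷ xs) (_ ∷ qs) fzero refl = refl
dist-flipAt-agree (true ∷ xs) (_ ∷ qs) fzero refl = refl
dist-flipAt-agree (x ∷ xs) (q ∷ qs) (fsuc j) x≡q =
  trans (cong (bitDist x q +_) (dist-flipAt-agree xs qs j x≡q)) (+-suc (bitDist x q) (dist xs qs))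

dist-flipAt-disagree : ∀ {n} (x q : Vertex n) (j : Fin n) →
  lookup x j ≢ lookup q j → suc (dist x (flipAt q j)) ≡ dist x q
dist-flipAt-disagree (false ∷ xs) (false ∷ qs) fzero x≢q = ⊥-elim (x≢q refl)
dist-flipAt-disagree (true ∷ xs) (true ∷ qs) fzero x≢q = ⊥-elim (x≢q refl)
dist-flipAt-disagree (false ∷ xs) (true ∷ qs) fzero _ = refl
dist-flipAt-disagree (true ∷ xs) (false ∷ qs) fzero _ = refl
dist-flipAt-disagree (x ∷ xs) (q ∷ qs) (fsuc j) x≢q =
  trans (sym (+-suc (bitDist x q) (dist xs (flipAt qs j))))
    (cong (bitDist x q +_) (dist-flipAt-disagree xs qs j x≢q))

dist-flipAt-≢ : ∀ {n} (x q : Vertex n) (j : Fin n) → dist x (flipAt q j) ≢ dist x q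
dist-flipAt-≢ x q j with lookup x j ≟ᵇ lookup q j
... | yes x≡q = 1+n≢n ∘ trans (sym (dist-flipAt-agree x q j x≡q))
... | no x≢q = λ eq → 1+n≢n (trans (dist-flipAt-disagree x q j x≢q) (sym eq))

dist-flipAt-≤⇒disagree : ∀ {n} (x q : Vertex n) (j : Fin n) →
  dist x (flipAt q j) ≤ dist x q → lookup x j ≢ lookup q j
dist-flipAt-≤⇒disagree x q j ≤q x≡q =
  <-irrefl refl (subst (_≤ dist x q) (dist-flipAt-agree x q j x≡q) ≤q)

distinct-disagreements≤dist : ∀ {n} (x q : Vertex n) {js : List (Fin n)} → Unique js →
  All (λ j → lookup x j ≢ lookup q j) js → length js ≤ dist x q
distinct-disagreements≤dist x q [] [] = z≤n
distinct-disagreements≤dist x q {j ∷ js} (j∉js ∷ distinct) (x≢q ∷ x≢qs) =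
  subst (suc (length js) ≤_) (dist-flipAt-disagree x q j x≢q)
    (s≤s (distinct-disagreements≤dist x (flipAt q j) distinct
      (All.zipWith (λ (j≢k , x≢q) e → x≢q (trans e (lookup-flipAt-≢ q j≢k))) (j∉js , x≢qs))))

dist≡0⇒≡ : ∀ {n} (x y : Vertex n) → dist x y ≡ 0 → x ≡ y
dist≡0⇒≡ [] [] _ = refl
dist≡0⇒≡ (false ∷ xs) (false ∷ ys) eq = cong (false ∷_) (dist≡0⇒≡ xs ys eq)
dist≡0⇒≡ (true ∷ xs) (true ∷ ys) eq = cong (true ∷_) (dist≡0⇒≡ xs ys eq)

∈N⇒flipAt : ∀ {n} {u v : Vertex n} → u ∈N v → ∃[ i ] u ≡ flipAt v i
∈N⇒flipAt {u = []} {[]} ()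
∈N⇒flipAt {u = false ∷ us} {false ∷ vs} eq
  with i , u≡ ← ∈N⇒flipAt {u = us} {vs} eq = fsuc i , cong (false ∷_) u≡
∈N⇒flipAt {u = true ∷ us} {true ∷ vs} eq
  with i , u≡ ← ∈N⇒flipAt {u = us} {vs} eq = fsuc i , cong (true ∷_) u≡
∈N⇒flipAt {u = true ∷ us} {false ∷ vs} eq =
  fzero , cong (true ∷_) (sym (dist≡0⇒≡ vs us (suc-injective eq)))
∈N⇒flipAt {u = false ∷ us} {true ∷ vs} eq =
  fzero , cong (false ∷_) (sym (dist≡0⇒≡ vs us (suc-injective eq)))

far-from-flipAt : ∀ {n} (y v : Vertex n) (i : Fin n) →
  dist y v ≤ 3 → 3 < dist y (flipAt v i) → lookup y i ≡ lookup v i × dist y v ≡ 3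
far-from-flipAt y v i close far with lookup y i ≟ᵇ lookup v i
... | yes y≡v = y≡v , ≤-antisym close (≤-pred (subst (3 <_) (dist-flipAt-agree y v i y≡v) far))
... | no y≢v = contradiction
  (≤-trans (n≤1+n _) (subst (_≤ 3) (sym (dist-flipAt-disagree y v i y≢v)) close)) (<⇒≱ far)

length-filter-map : ∀ {A B : Set} {P : Pred B 0ℓ} (P? : Decidable P) (f : A → B) (xs : List A) →
  length (filter P? (map f xs)) ≡ length (filter (P? ∘ f) xs)
length-filter-map P? f [] = refl
length-filter-map P? f (x ∷ xs) with does (P? (f x))
... | true = cong suc (length-filter-map P? f xs)
... | false = length-filter-map P? f xs

neighbourDirections : ∀ {n} → VSet n → Vertex n → List (Fin n)
neighbourDirections σ v = filter (λ j → T? (σ (flipAt v j))) (allFin _)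

degIn≡length-neighbourDirections : ∀ {n} (σ : VSet n) (v : Vertex n) →
  degIn σ v ≡ length (neighbourDirections σ v)
degIn≡length-neighbourDirections {n} σ v =
  trans (cong (length ∘ filter (λ w → T? (σ w))) (sym (map-tabulate (λ j → j) (flipAt v))))
    (length-filter-map (λ w → T? (σ w)) (flipAt v) (allFin n))

neighbourDirections-unique : ∀ {n} (σ : VSet n) (v : Vertex n) → Unique (neighbourDirections σ v)
neighbourDirections-unique {n} σ v = filter⁺ _ (allFin⁺ n)

neighbourDirections-∈ : ∀ {n} (σ : VSet n) (v : Vertex n) →
  All (λ j → flipAt v j ∈ₛ σ) (neighbourDirections σ v)
neighbourDirections-∈ {n} σ v = All.map (Equivalence.to T-≡) (all-filter _ (allFin n))

adjoin : ∀ {n} → VSet n → Vertex n → VSet n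
adjoin σ u w = σ w ∨ does (≡-dec _≟ᵇ_ w u)

∈-adjoin⁻ : ∀ {n} {σ : VSet n} {u w : Vertex n} → w ∈ₛ adjoin σ u → w ∈ₛ σ ⊎ w ≡ u
∈-adjoin⁻ {σ = σ} {u} {w} w∈ with σ w | ≡-dec _≟ᵇ_ w u
... | true | _ = inj₁ refl
... | false | yes w≡u = inj₂ w≡u

∈-adjoin⁺ : ∀ {n} (σ : VSet n) (u : Vertex n) {w : Vertex n} → w ∈ₛ σ → w ∈ₛ adjoin σ u
∈-adjoin⁺ σ u w∈σ = cong (_∨ _) w∈σ

∈-adjoin-self : ∀ {n} (σ : VSet n) (u : Vertex n) → u ∈ₛ adjoin σ u
∈-adjoin-self σ u = trans (cong (σ u ∨_) (dec-true (≡-dec _≟ᵇ_ u u) refl)) (∨-zeroʳ (σ u))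

maximal-absorbs : ∀ {n} {σ : VSet n} {u : Vertex n} → IsMaximalSimplex σ →
  (∀ w → w ∈ₛ σ → dist u w ≤ 3) → u ∈ₛ σ
maximal-absorbs {σ = σ} {u} (((v , v∈σ) , diam) , maximal) close =
  maximal (adjoin σ u) ((v , ∈-adjoin⁺ σ u v∈σ) , diam′) (λ _ → ∈-adjoin⁺ σ u) u (∈-adjoin-self σ u)
  where
  diam′ : ∀ w w′ → w ∈ₛ adjoin σ u → w′ ∈ₛ adjoin σ u → dist w w′ ≤ 3
  diam′ w w′ w∈ w′∈ with ∈-adjoin⁻ {σ = σ} w∈ | ∈-adjoin⁻ {σ = σ} w′∈
  ... | inj₁ w∈σ | inj₁ w′∈σ = diam w w′ w∈σ w′∈σ
  ... | inj₁ w∈σ | inj₂ refl = subst (_≤ 3) (dist-sym u w) (close w w∈σ)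
  ... | inj₂ refl | inj₁ w′∈σ = close w′ w′∈σ
  ... | inj₂ refl | inj₂ refl = subst (_≤ 3) (sym (dist-refl u)) z≤n

disagreeing-member : ∀ {n} {σ : VSet n} → CoversAllPlaces σ →
  ∀ (v : Vertex n) i → ∃[ x ] x ∈ₛ σ × lookup x i ≢ lookup v i
disagreeing-member covers v i with covers i | lookup v i
... | _ , q , _ , q∈σ , _ , q≡false | true =
  q , q∈σ , λ q≡true → contradiction (trans (sym q≡false) q≡true) λ ()
... | p , _ , p∈σ , _ , p≡true , _ | false =
  p , p∈σ , λ p≡false → contradiction (trans (sym p≡true) p≡false) λ ()

Unique⇒∃≢ : ∀ {n} {P : Pred (Fin n) 0ℓ} {js : List (Fin n)} →
  Unique js → 2 ≤ length js → All P js → ∀ i → ∃[ j ] j ≢ i × P j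
Unique⇒∃≢ ((j≢k ∷ _) ∷ _) (s≤s (s≤s z≤n)) (Pj ∷ Pk ∷ _) i with _ ≟ᶠ i
... | no j≢i = _ , j≢i , Pj
... | yes refl = _ , j≢k ∘ sym , Pk

module _ {n} {σ : VSet n} (diam : ∀ v w → v ∈ₛ σ → w ∈ₛ σ → dist v w ≤ 3)
         {v : Vertex n} (v∈σ : v ∈ₛ σ) (3≤deg : 3 ≤ degIn σ v) where

  private
    J = neighbourDirections σ v

    3≤∣J∣ : 3 ≤ length J
    3≤∣J∣ = subst (3 ≤_) (degIn≡length-neighbourDirections σ v) 3≤deg

    disagree-on-J : ∀ {x} → x ∈ₛ σ → dist x v ≡ 3 → All (λ j → lookup x j ≢ lookup v j) J
    disagree-on-J {x} x∈σ x-v≡3 = All.map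
      (λ {j} vj∈σ → dist-flipAt-≤⇒disagree x v j
         (subst (dist x (flipAt v j) ≤_) (sym x-v≡3) (diam x _ x∈σ vj∈σ)))
      (neighbourDirections-∈ σ v)

  module _ {i : Fin n} {y : Vertex n} (y∈σ : y ∈ₛ σ) (far : 3 < dist y (flipAt v i)) where

    private
      y-i≡v-i : lookup y i ≡ lookup v i
      y-i≡v-i = proj₁ (far-from-flipAt y v i (diam y v y∈σ v∈σ) far)

      y-v≡3 : dist y v ≡ 3
      y-v≡3 = proj₂ (far-from-flipAt y v i (diam y v y∈σ v∈σ) far)

      i∉J : All (i ≢_) J
      i∉J = All.map (λ { y≢v refl → y≢v y-i≡v-i }) (disagree-on-J y∈σ y-v≡3)

    dist≡2 : ∀ {x} → x ∈ₛ σ → lookup x i ≢ lookup v i → dist x v ≡ 2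
    dist≡2 {x} x∈σ x≢v = ≤-antisym (≤-pred (≤∧≢⇒< (diam x v x∈σ v∈σ) ≢3)) 2≤
      where
      2≤ : 2 ≤ dist x v
      2≤ = +-cancelʳ-≤ 3 2 (dist x v) (≤-trans
             (subst (λ d → 2 + d ≤ dist x v + dist x y) (trans (dist-sym v y) y-v≡3)
               (dist-detour x v y i (sym y-i≡v-i) x≢v))
             (+-monoʳ-≤ (dist x v) (diam x y x∈σ y∈σ)))

      ≢3 : dist x v ≢ 3
      ≢3 x-v≡3 = <⇒≱ (≤-trans (s≤s 3≤∣J∣) (distinct-disagreements≤dist x v
          (i∉J ∷ neighbourDirections-unique σ v) (x≢v ∷ disagree-on-J x∈σ x-v≡3))) (≤-reflexive x-v≡3)

    no-far-vertex : CoversAllPlaces σ → (∀ w → w ∈ₛ σ → 2 ≤ degIn σ w) → ⊥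
    no-far-vertex covers 2≤deg
      with x , x∈σ , x≢v ← disagreeing-member covers v i
      with j , j≢i , xj∈σ ← Unique⇒∃≢ (neighbourDirections-unique σ x)
             (subst (2 ≤_) (degIn≡length-neighbourDirections σ x) (2≤deg x x∈σ))
             (neighbourDirections-∈ σ x) i
      = dist-flipAt-≢ v x j (begin
          dist v (flipAt x j) ≡⟨ dist-sym v (flipAt x j) ⟩
          dist (flipAt x j) v ≡⟨ dist≡2 xj∈σ (x≢v ∘ trans (sym (lookup-flipAt-≢ x j≢i))) ⟩
          2                   ≡⟨ sym (dist≡2 x∈σ x≢v) ⟩
          dist x v            ≡⟨ dist-sym x v ⟩
          dist v x            ∎)
      where open ≡-Reasoning

  flipAt-within-3 : CoversAllPlaces σ → (∀ w → w ∈ₛ σ → 2 ≤ degIn σ w) →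
    ∀ i w → w ∈ₛ σ → dist (flipAt v i) w ≤ 3
  flipAt-within-3 covers 2≤deg i w w∈σ with dist (flipAt v i) w ≤? 3
  ... | yes ≤3 = ≤3
  ... | no ≰3 =
    ⊥-elim (no-far-vertex w∈σ (subst (3 <_) (dist-sym (flipAt v i) w) (≰⇒> ≰3)) covers 2≤deg)

-- The argument does not use n ≥ 5.
lemma4p5 : (n : ℕ) → 5 ≤ n → (σ : VSet n) →
    IsMaximalSimplex σ → CoversAllPlaces σ →
    (∀ w → w ∈ₛ σ → 2 ≤ degIn σ w) →
    (v : Vertex n) → v ∈ₛ σ → 3 ≤ degIn σ v →
    ∀ u → u ∈N v → u ∈ₛ σ
lemma4p5 _ _ σ maximal@((_ , diam) , _) covers 2≤deg v v∈σ 3≤deg u u∈Nv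
  with i , refl ← ∈N⇒flipAt {u = u} {v} u∈Nv
  = maximal-absorbs maximal (flipAt-within-3 diam v∈σ 3≤deg covers 2≤deg i)
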